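{- Let $a,n$ be positive integers. Then $T(an)\supseteq \bigl(T(a)\cup T(n)\bigr)\setminus\Omega(an)$.
   Context: For an integer $n$, a Toda prime of $n$ is an odd prime $p$ such that $p-1\mid 4n$ and $\gcd\!\left(p,\frac{4n}{p-1}\right)=1$. $T(n)$ denotes the set of Toda primes of $n$. For a positive integer $n$, $\Omega(n)$ denotes the set of prime divisors of $n$. -}

module Defs where

open import Data.Nat using (ℕ; _*_; _∸_)
open import Data.Nat.Divisibility using (_∣_)
open import Data.Nat.Primality using (Prime)
open import Data.Nat.GCD using (gcd)
open import Data.Product using (_×_; ∃-syntax)
open import Relation.Binary.PropositionalEquality using (_≡_; _≢_)
open import Relation.Nullary using (¬_)

-- p is a Toda prime of n: p odd prime, (p-1) ∣ 4n, gcd(p, 4n/(p-1)) = 1.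
-- Since p ≥ 3, p-1 > 0 so the quotient 4n/(p-1) is the unique k with 4n = k*(p-1);
-- we write the divisibility together with the quotient explicitly.
record Toda (n p : ℕ) : Set where
  field
    prime : Prime p
    odd   : p ≢ 2
    quot  : ℕ
    quot-eq : 4 * n ≡ quot * (p ∸ 1)
    coprime : gcd p quot ≡ 1

PrimeDivisor : ℕ → ℕ → Set
PrimeDivisor m p = Prime p × p ∣ m

{-# OPTIONS --safe #-}
-- If 4n = q (p - 1) with gcd(p, q) = 1, then 4nm = (q m)(p - 1), and the new quotient q m
-- stays coprime to the prime p exactly when p ∤ m; p ∉ Ω(an) gives p ∤ a and p ∤ n.
module Submission where

open import Defs
open import Data.Nat using (ℕ; _*_; _∸_; NonZero)
open import Data.Nat.Properties using (*-assoc; *-comm; *-commutativeSemigroup)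
open import Data.Nat.Divisibility using (_∤_; ∣-trans; m∣m*n; n∣m*n)
open import Data.Nat.Primality using (Prime; prime⇒irreducible)
open import Data.Nat.Coprimality using (Coprime; coprime-divisor; gcd≡1⇒coprime; coprime⇒gcd≡1)
open import Data.Product using (_,_)
open import Data.Sum using (_⊎_; inj₁; inj₂)
open import Relation.Binary.PropositionalEquality using (_≡_; refl; cong; subst; module ≡-Reasoning)
open import Relation.Nullary using (¬_; contradiction)
open import Algebra.Properties.CommutativeSemigroup *-commutativeSemigroup using (xy∙z≈xz∙y)

coprime-* : ∀ {m n o} → Coprime m n → Coprime m o → Coprime m (n * o)
coprime-* {m} {n} m⊥n m⊥o (d∣m , d∣n*o) = m⊥o (d∣m , coprime-divisor d⊥n d∣n*o)
  where
  d⊥n : Coprime _ n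
  d⊥n (e∣d , e∣n) = m⊥n (∣-trans e∣d d∣m , e∣n)

prime∧∤⇒coprime : ∀ {p m} → Prime p → p ∤ m → Coprime p m
prime∧∤⇒coprime p-prime p∤m (d∣p , d∣m) with prime⇒irreducible p-prime d∣p
... | inj₁ d≡1 = d≡1
... | inj₂ refl = contradiction d∣m p∤m

Toda-*ʳ : ∀ {n p} m → Toda n p → p ∤ m → Toda (n * m) p
Toda-*ʳ {n} {p} m t p∤m = record
  { prime   = prime
  ; odd     = odd
  ; quot    = quot * m
  ; quot-eq = quot*m-eq
  ; coprime = coprime⇒gcd≡1
      (coprime-* (gcd≡1⇒coprime coprime) (prime∧∤⇒coprime prime p∤m))
  }
  where
  open Toda t
  quot*m-eq : 4 * (n * m) ≡ quot * m * (p ∸ 1)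
  quot*m-eq = begin
    4 * (n * m)        ≡⟨ *-assoc 4 n m ⟨
    4 * n * m          ≡⟨ cong (_* m) quot-eq ⟩
    quot * (p ∸ 1) * m ≡⟨ xy∙z≈xz∙y quot (p ∸ 1) m ⟩
    quot * m * (p ∸ 1) ∎
    where open ≡-Reasoning

lemma2p3 : (a n : ℕ) → .{{NonZero a}} → .{{NonZero n}} → (p : ℕ) →
    (Toda a p ⊎ Toda n p) → ¬ PrimeDivisor (a * n) p → Toda (a * n) p
lemma2p3 a n p (inj₁ t) p∉Ω = Toda-*ʳ n t p∤n
  where
  p∤n : p ∤ n
  p∤n p∣n = p∉Ω (Toda.prime t , ∣-trans p∣n (n∣m*n a))
lemma2p3 a n p (inj₂ t) p∉Ω = subst (λ m → Toda m p) (*-comm n a) (Toda-*ʳ a t p∤a)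
  where
  p∤a : p ∤ a
  p∤a p∣a = p∉Ω (Toda.prime t , ∣-trans p∣a (m∣m*n n))
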